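{- For every permutation $w \in \mathfrak{S}_n$, the posets $\mathcal{P}(w)$ and $\overline{\mathcal{P}}(w)$ are planar, i.e. each admits a Hasse diagram drawn in the plane with no crossing edges.
   Context: A permutation $w \in \mathfrak{S}_n$ is written in one-line notation $w(1)w(2)\cdots w(n)$. An interval of $w$ is a set of consecutive integers $[h,h+j]$ (possibly empty) whose elements occupy consecutive positions of $w$, i.e. $\{w(t) : t \in [i,i+j]\} = [h,h+j]$ for some $i$. The interval poset $\mathcal{P}(w)$ is the set of nonempty intervals of $w$ ordered by inclusion; the closed interval poset $\overline{\mathcal{P}}(w)$ is obtained from $\mathcal{P}(w)$ by adjoining a minimum element $\widehat{0}$ (representing the empty interval). -}

module Defs where

open import Data.Nat using (ℕ; _+_; _≤_; _<_)
open import Data.Fin using (Fin; toℕ)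
open import Data.Fin.Permutation using (Permutation′; _⟨$⟩ʳ_)
open import Data.Product using (Σ; _×_; _,_; proj₁; proj₂)
open import Data.Sum using (_⊎_)
open import Data.Maybe using (Maybe; just; nothing)
open import Data.Unit using (⊤)
open import Data.Empty using (⊥)
open import Relation.Nullary using (¬_)
open import Relation.Binary.PropositionalEquality using (_≡_)
open import Function.Bundles using (_⇔_)
import Data.Rational as Q
open Q using (ℚ; 0ℚ; 1ℚ)

-- Intervals of a permutation (values and positions are 0-indexed:
-- w : Fin n → Fin n).  The pair (h , j) stands for the value set
-- [h, h+j] (always nonempty).

IsInterval : ∀ {n} → Permutation′ n → ℕ × ℕ → Set
IsInterval {n} w (h , j) =
  (h + j < n) ×
  Σ ℕ λ i → (i + j < n) ×
    (∀ (v : Fin n) →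
      ((h ≤ toℕ v) × (toℕ v ≤ h + j)) ⇔
      Σ (Fin n) λ t → (i ≤ toℕ t) × (toℕ t ≤ i + j) × (w ⟨$⟩ʳ t ≡ v))

_⊑_ : ℕ × ℕ → ℕ × ℕ → Set
(h , j) ⊑ (h' , j') = (h' ≤ h) × (h + j ≤ h' + j')

-- Interval poset P(w): carrier ℕ × ℕ restricted to IsInterval w, order ⊑.

-- Closed interval poset: nothing = the adjoined minimum 0̂.
IsIntervalBar : ∀ {n} → Permutation′ n → Maybe (ℕ × ℕ) → Set
IsIntervalBar w nothing  = ⊤
IsIntervalBar w (just I) = IsInterval w I

_⊑̄_ : Maybe (ℕ × ℕ) → Maybe (ℕ × ℕ) → Set
nothing ⊑̄ _        = ⊤
just I  ⊑̄ nothing  = ⊥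
just I  ⊑̄ just J   = I ⊑ J

Point : Set
Point = ℚ × ℚ

OnSegment : Point → Point → Point → Set
OnSegment q a b =
  Σ ℚ λ t → (0ℚ Q.≤ t) × (t Q.≤ 1ℚ) ×
    (q ≡ (proj₁ a Q.+ t Q.* (proj₁ b Q.- proj₁ a) ,
          proj₂ a Q.+ t Q.* (proj₂ b Q.- proj₂ a)))

module _ {X : Set} (E : X → Set) (_≼_ : X → X → Set) where

  Covers : X → X → Set
  Covers x y = E x × E y × (x ≼ y) × ¬ (x ≡ y) ×
    (∀ z → E z → x ≼ z → z ≼ y → (z ≡ x) ⊎ (z ≡ y))

  IsPlanarDrawing : (X → Point) → Set
  IsPlanarDrawing p =
    (∀ x y → E x → E y → p x ≡ p y → x ≡ y) ×
    (∀ x y → Covers x y → proj₂ (p x) Q.< proj₂ (p y)) ×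
    (∀ x y z → Covers x y → E z → OnSegment (p z) (p x) (p y) →
       (z ≡ x) ⊎ (z ≡ y)) ×
    (∀ x y x' y' → Covers x y → Covers x' y' → ¬ ((x ≡ x') × (y ≡ y')) →
       ∀ q → OnSegment q (p x) (p y) → OnSegment q (p x') (p y') →
       Σ X λ z → ((z ≡ x) ⊎ (z ≡ y)) × ((z ≡ x') ⊎ (z ≡ y')) × (q ≡ p z))

  Planar : Set
  Planar = Σ (X → Point) IsPlanarDrawing

module Submission where

open import Defs
open import Data.Nat using (ℕ)
open import Data.Product using (_×_; _,_)
open import Data.Fin.Permutation using (Permutation′)

-- Draw the interval [h, h + j] at (h, j) and 0̂ at (0, -1). Along an edge I ⋖ J the left
-- end of the interval moves down and the right end up, so a point shared by two edges
-- I ⋖ J and I' ⋖ J' forces I ⊆ J' and I' ⊆ J. Then K = J ∩ J' is an interval with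
-- I ⊆ K ⊆ J and I' ⊆ K ⊆ J', so K is an end of both edges, and in each case the common
-- point is pinned to a common end, except when J = J'. In that case, if I and I' overlap,
-- their union is an interval squeezed between them and J, hence equal to J, which again
-- pins the point; if they are disjoint, the two segments into J are not collinear.
-- The covers of 0̂ are the singletons, which lie below every other edge.

module Plane where

  open import Defs
  open import Data.Nat as ℕ using (ℕ; zero; suc)
  import Data.Nat.Properties as ℕₚ
  open import Data.Product using (_×_; _,_; proj₁; proj₂)
  open import Relation.Binary.PropositionalEquality
  open import Relation.Nullary using (yes; no)
  open import Data.Empty using (⊥-elim)
  open import Data.Rational as ℚ using (ℚ; 0ℚ; 1ℚ; _+_; _*_; _-_; -_; _≤_; _<_)
  import Data.Rational.Properties as ℚₚ
  open import Data.Rational.Solver using (module +-*-Solver)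
  open +-*-Solver using (solve; _:+_; _:-_; _:*_; con; _:=_)

  fromℕ : ℕ → ℚ
  fromℕ zero    = 0ℚ
  fromℕ (suc n) = 1ℚ + fromℕ n

  fromℕ-+ : ∀ m n → fromℕ (m ℕ.+ n) ≡ fromℕ m + fromℕ n
  fromℕ-+ zero    n = sym (ℚₚ.+-identityˡ (fromℕ n))
  fromℕ-+ (suc m) n = trans (cong (1ℚ +_) (fromℕ-+ m n)) (sym (ℚₚ.+-assoc 1ℚ (fromℕ m) (fromℕ n)))

  fromℕ-nonNeg : ∀ n → 0ℚ ≤ fromℕ n
  fromℕ-nonNeg zero    = ℚₚ.≤-refl
  fromℕ-nonNeg (suc n) = ℚₚ.+-mono-≤ (ℚₚ.<⇒≤ (ℚₚ.positive⁻¹ 1ℚ)) (fromℕ-nonNeg n)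

  fromℕ-mono-≤ : ∀ {m n} → m ℕ.≤ n → fromℕ m ≤ fromℕ n
  fromℕ-mono-≤ {zero}  {n}     _           = fromℕ-nonNeg n
  fromℕ-mono-≤ {suc m} {suc n} (ℕ.s≤s m≤n) = ℚₚ.+-monoʳ-≤ 1ℚ (fromℕ-mono-≤ m≤n)

  fromℕ-mono-< : ∀ {m n} → m ℕ.< n → fromℕ m < fromℕ n
  fromℕ-mono-< {zero}  {suc n} _           = ℚₚ.+-mono-<-≤ (ℚₚ.positive⁻¹ 1ℚ) (fromℕ-nonNeg n)
  fromℕ-mono-< {suc m} {suc n} (ℕ.s≤s m<n) = ℚₚ.+-monoʳ-< 1ℚ (fromℕ-mono-< m<n)

  fromℕ-cancel-≤ : ∀ {m n} → fromℕ m ≤ fromℕ n → m ℕ.≤ n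
  fromℕ-cancel-≤ {m} {n} le with m ℕ.≤? n
  ... | yes m≤n = m≤n
  ... | no  m≰n = ⊥-elim (ℚₚ.<-irrefl refl (ℚₚ.≤-<-trans le (fromℕ-mono-< (ℕₚ.≰⇒> m≰n))))

  fromℕ-injective : ∀ {m n} → fromℕ m ≡ fromℕ n → m ≡ n
  fromℕ-injective e = ℕₚ.≤-antisym (fromℕ-cancel-≤ (ℚₚ.≤-reflexive e)) (fromℕ-cancel-≤ (ℚₚ.≤-reflexive (sym e)))

  p≤q⇒0≤q-p : ∀ {p q} → p ≤ q → 0ℚ ≤ q - p
  p≤q⇒0≤q-p {p} {q} p≤q = subst (_≤ q - p) (ℚₚ.+-inverseʳ p) (ℚₚ.+-monoˡ-≤ (- p) p≤q)

  0≤q-p⇒p≤q : ∀ {p q} → 0ℚ ≤ q - p → p ≤ q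
  0≤q-p⇒p≤q {p} {q} 0≤q-p =
    subst₂ _≤_ (ℚₚ.+-identityʳ p) (solve 2 (λ p q → p :+ (q :- p) := q) refl p q) (ℚₚ.+-monoʳ-≤ p 0≤q-p)

  *-nonNeg : ∀ {p q} → 0ℚ ≤ p → 0ℚ ≤ q → 0ℚ ≤ p * q
  *-nonNeg {p} {q} 0≤p 0≤q =
    ℚₚ.nonNegative⁻¹ (p * q) {{ℚₚ.nonNeg*nonNeg⇒nonNeg p {{ℚ.nonNegative 0≤p}} q {{ℚ.nonNegative 0≤q}}}}

  p*q≡0⇒p≡0 : ∀ p q → p * q ≡ 0ℚ → q ≢ 0ℚ → p ≡ 0ℚ
  p*q≡0⇒p≡0 p q pq≡0 q≢0 = begin
    p                ≡⟨ sym (ℚₚ.*-identityʳ p) ⟩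
    p * 1ℚ           ≡⟨ cong (p *_) (sym (ℚₚ.*-inverseʳ q {{ℚ.≢-nonZero q≢0}})) ⟩
    p * (q * q⁻¹)    ≡⟨ sym (ℚₚ.*-assoc p q q⁻¹) ⟩
    (p * q) * q⁻¹    ≡⟨ cong (_* q⁻¹) pq≡0 ⟩
    0ℚ * q⁻¹         ≡⟨ ℚₚ.*-zeroˡ q⁻¹ ⟩
    0ℚ               ∎
    where
    open ≡-Reasoning
    q⁻¹ : ℚ
    q⁻¹ = ℚ.1/_ q {{ℚ.≢-nonZero q≢0}}

  p≢q⇒p-q≢0 : ∀ {p q} → p ≢ q → p - q ≢ 0ℚ
  p≢q⇒p-q≢0 {p} {q} p≢q p-q≡0 = p≢q (begin
    p               ≡⟨ solve 2 (λ p q → p := (p :- q) :+ q) refl p q ⟩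
    (p - q) + q     ≡⟨ cong (_+ q) p-q≡0 ⟩
    0ℚ + q          ≡⟨ ℚₚ.+-identityˡ q ⟩
    q               ∎)
    where open ≡-Reasoning

  *-cross-< : ∀ {x x' y y'} → 0ℚ ≤ x → x < x' → 0ℚ ≤ y' → y' < y → x * y' < x' * y
  *-cross-< {x} {x'} {y} {y'} 0≤x x<x' 0≤y' y'<y = ℚₚ.≤-<-trans
    (ℚₚ.*-monoˡ-≤-nonNeg x {{ℚ.nonNegative 0≤x}} (ℚₚ.<⇒≤ y'<y))
    (ℚₚ.*-monoˡ-<-pos y {{ℚ.positive (ℚₚ.≤-<-trans 0≤y' y'<y)}} x<x')

  lerp : ℚ → ℚ → ℚ → ℚ
  lerp t x y = x + t * (y - x)

  InUnitInterval : ℚ → Set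
  InUnitInterval t = (0ℚ ≤ t) × (t ≤ 1ℚ)

  lerp-between : ∀ {t x y} → InUnitInterval t → x ≤ y → (x ≤ lerp t x y) × (lerp t x y ≤ y)
  lerp-between {t} {x} {y} (0≤t , t≤1) x≤y =
    0≤q-p⇒p≤q (subst (0ℚ ≤_) (solve 3 (λ t x y → t :* (y :- x) := (x :+ t :* (y :- x)) :- x) refl t x y)
      (*-nonNeg 0≤t (p≤q⇒0≤q-p x≤y))) ,
    0≤q-p⇒p≤q (subst (0ℚ ≤_) (solve 3 (λ t x y → (con 1ℚ :- t) :* (y :- x) := y :- (x :+ t :* (y :- x))) refl t x y)
      (*-nonNeg (p≤q⇒0≤q-p t≤1) (p≤q⇒0≤q-p x≤y)))

  lerp-between-rev : ∀ {t x y} → InUnitInterval t → y ≤ x → (y ≤ lerp t x y) × (lerp t x y ≤ x)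
  lerp-between-rev {t} {x} {y} (0≤t , t≤1) y≤x =
    0≤q-p⇒p≤q (subst (0ℚ ≤_) (solve 3 (λ t x y → (con 1ℚ :- t) :* (x :- y) := (x :+ t :* (y :- x)) :- y) refl t x y)
      (*-nonNeg (p≤q⇒0≤q-p t≤1) (p≤q⇒0≤q-p y≤x))) ,
    0≤q-p⇒p≤q (subst (0ℚ ≤_) (solve 3 (λ t x y → t :* (x :- y) := x :- (x :+ t :* (y :- x))) refl t x y)
      (*-nonNeg 0≤t (p≤q⇒0≤q-p y≤x)))

  lerp-at-one : ∀ {t} x y → 1ℚ - t ≡ 0ℚ → lerp t x y ≡ y
  lerp-at-one {t} x y 1-t≡0 = begin
    x + t * (y - x)            ≡⟨ solve 3 (λ t x y → x :+ t :* (y :- x) := y :- (con 1ℚ :- t) :* (y :- x)) refl t x y ⟩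
    y - (1ℚ - t) * (y - x)     ≡⟨ cong (λ s → y - s * (y - x)) 1-t≡0 ⟩
    y - 0ℚ * (y - x)           ≡⟨ solve 2 (λ x y → y :- con 0ℚ :* (y :- x) := y) refl x y ⟩
    y                          ∎
    where open ≡-Reasoning

  segment-at-one : ∀ {q a b} (s : OnSegment q a b) → 1ℚ - proj₁ s ≡ 0ℚ → q ≡ b
  segment-at-one {a = a₁ , a₂} {b₁ , b₂} (t , _ , _ , refl) 1-t≡0 =
    cong₂ _,_ (lerp-at-one {t} a₁ b₁ 1-t≡0) (lerp-at-one {t} a₂ b₂ 1-t≡0)

  OnSegment-sym : ∀ {q} a b → OnSegment q a b → OnSegment q b a
  OnSegment-sym (a₁ , a₂) (b₁ , b₂) (t , 0≤t , t≤1 , refl) =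
    1ℚ - t , p≤q⇒0≤q-p t≤1 ,
    0≤q-p⇒p≤q (subst (0ℚ ≤_) (solve 1 (λ t → t := con 1ℚ :- (con 1ℚ :- t)) refl t) 0≤t) ,
    cong₂ _,_ (flip a₁ b₁) (flip a₂ b₂)
    where
    flip : ∀ x y → lerp t x y ≡ lerp (1ℚ - t) y x
    flip = solve 3 (λ t x y → x :+ t :* (y :- x) := y :+ (con 1ℚ :- t) :* (x :- y)) refl t

  orientation : Point → Point → Point → ℚ
  orientation (c₁ , c₂) (a₁ , a₂) (b₁ , b₂) = (a₁ - c₁) * (b₂ - c₂) - (a₂ - c₂) * (b₁ - c₁)

  segments-into-common-end : ∀ {q} a b c → orientation c a b ≢ 0ℚ →
                             OnSegment q a c → OnSegment q b c → q ≡ c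
  segments-into-common-end (a₁ , a₂) (b₁ , b₂) (c₁ , c₂) Δ≢0 s@(t , _ , _ , refl) (u , _ , _ , e) =
    segment-at-one {a = a₁ , a₂} {c₁ , c₂} s (p*q≡0⇒p≡0 (1ℚ - t) Δ scaled Δ≢0)
    where
    open ≡-Reasoning
    Δ : ℚ
    Δ = orientation (c₁ , c₂) (a₁ , a₂) (b₁ , b₂)
    -- q - c is (1 - t) (a - c) and also a multiple of b - c.
    scaled : (1ℚ - t) * Δ ≡ 0ℚ
    scaled = begin
      (1ℚ - t) * Δ
        ≡⟨ solve 7 (λ t a₁ a₂ b₁ b₂ c₁ c₂ →
             (con 1ℚ :- t) :* ((a₁ :- c₁) :* (b₂ :- c₂) :- (a₂ :- c₂) :* (b₁ :- c₁)) :=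
             ((a₁ :+ t :* (c₁ :- a₁)) :- c₁) :* (b₂ :- c₂) :- ((a₂ :+ t :* (c₂ :- a₂)) :- c₂) :* (b₁ :- c₁))
             refl t a₁ a₂ b₁ b₂ c₁ c₂ ⟩
      (lerp t a₁ c₁ - c₁) * (b₂ - c₂) - (lerp t a₂ c₂ - c₂) * (b₁ - c₁)
        ≡⟨ cong₂ (λ x y → (x - c₁) * (b₂ - c₂) - (y - c₂) * (b₁ - c₁)) (cong proj₁ e) (cong proj₂ e) ⟩
      (lerp u b₁ c₁ - c₁) * (b₂ - c₂) - (lerp u b₂ c₂ - c₂) * (b₁ - c₁)
        ≡⟨ solve 5 (λ u b₁ b₂ c₁ c₂ →
             ((b₁ :+ u :* (c₁ :- b₁)) :- c₁) :* (b₂ :- c₂) :- ((b₂ :+ u :* (c₂ :- b₂)) :- c₂) :* (b₁ :- c₁) := con 0ℚ)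
             refl u b₁ b₂ c₁ c₂ ⟩
      0ℚ ∎

  segment-top : ∀ {q} a b → OnSegment q a b → proj₂ a < proj₂ b → proj₂ b ≤ proj₂ q → q ≡ b
  segment-top (a₁ , a₂) (b₁ , b₂) s@(t , 0≤t , t≤1 , refl) a₂<b₂ b₂≤q₂ =
    segment-at-one {a = a₁ , a₂} {b₁ , b₂} s (p*q≡0⇒p≡0 (1ℚ - t) (b₂ - a₂) scaled (p≢q⇒p-q≢0 (≢-sym (ℚₚ.<⇒≢ a₂<b₂))))
    where
    open ≡-Reasoning
    q₂≡b₂ : lerp t a₂ b₂ ≡ b₂
    q₂≡b₂ = ℚₚ.≤-antisym (proj₂ (lerp-between (0≤t , t≤1) (ℚₚ.<⇒≤ a₂<b₂))) b₂≤q₂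
    scaled : (1ℚ - t) * (b₂ - a₂) ≡ 0ℚ
    scaled = begin
      (1ℚ - t) * (b₂ - a₂)  ≡⟨ solve 3 (λ t a b → (con 1ℚ :- t) :* (b :- a) := b :- (a :+ t :* (b :- a))) refl t a₂ b₂ ⟩
      b₂ - lerp t a₂ b₂     ≡⟨ cong (λ y → b₂ - y) q₂≡b₂ ⟩
      b₂ - b₂               ≡⟨ ℚₚ.+-inverseʳ b₂ ⟩
      0ℚ                    ∎

module Intervals where

  open import Defs
  open import Data.Nat using (ℕ; suc; _+_; _∸_; _≤_; _<_; _⊔_; _⊓_; s≤s; s≤s⁻¹; _≤?_)
  open import Data.Nat.Properties
  open import Data.Fin using (Fin; toℕ; fromℕ<)
  import Data.Fin.Properties as Finₚ
  open import Data.Fin.Permutation using (Permutation′; _⟨$⟩ʳ_; _⟨$⟩ˡ_; inverseˡ; inverseʳ; flip)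
  open import Data.Product using (Σ; _×_; _,_; proj₁; proj₂)
  open import Data.Sum using (_⊎_; inj₁; inj₂)
  open import Function.Bundles using (Equivalence; mk⇔)
  open import Function.Definitions using (Injective)
  open import Relation.Binary.PropositionalEquality
  open import Relation.Nullary using (yes; no)
  open import Data.Empty using (⊥-elim)

  _∈[_,_] : ℕ → ℕ → ℕ → Set
  x ∈[ l , u ] = (l ≤ x) × (x ≤ u)

  injective⇒range-length-≤ : ∀ {m n} (f : Fin m → Fin n) → Injective _≡_ _≡_ f →
                             ∀ {i i' l l'} → i ≤ i' → i' < m →
                             (∀ t → toℕ t ∈[ i , i' ] → toℕ (f t) ∈[ l , l' ]) → i' ∸ i ≤ l' ∸ l
  injective⇒range-length-≤ {m} f f-inj {i} {i'} {l} {l'} i≤i' i'<m maps =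
    s≤s⁻¹ (Finₚ.injective⇒≤ g-injective)
    where
    offset-bound : (k : Fin (suc (i' ∸ i))) → i + toℕ k ≤ i'
    offset-bound k = ≤-trans (+-monoʳ-≤ i (s≤s⁻¹ (Finₚ.toℕ<n k))) (≤-reflexive (m+[n∸m]≡n i≤i'))
    pos : Fin (suc (i' ∸ i)) → Fin m
    pos k = fromℕ< (≤-<-trans (offset-bound k) i'<m)
    toℕ-pos : ∀ k → toℕ (pos k) ≡ i + toℕ k
    toℕ-pos k = Finₚ.toℕ-fromℕ< _
    value-bounds : ∀ k → toℕ (f (pos k)) ∈[ l , l' ]
    value-bounds k = maps (pos k) (subst (i ≤_) (sym (toℕ-pos k)) (m≤m+n i (toℕ k)) ,
                                   subst (_≤ i') (sym (toℕ-pos k)) (offset-bound k))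
    g : Fin (suc (i' ∸ i)) → Fin (suc (l' ∸ l))
    g k = fromℕ< (s≤s (∸-monoˡ-≤ l (proj₂ (value-bounds k))))
    g-injective : Injective _≡_ _≡_ g
    g-injective {k} {k'} e = Finₚ.toℕ-injective (+-cancelˡ-≡ i _ _
      (trans (sym (toℕ-pos k)) (trans (cong toℕ (f-inj (Finₚ.toℕ-injective same-value))) (toℕ-pos k'))))
      where
      same-value : toℕ (f (pos k)) ≡ toℕ (f (pos k'))
      same-value = ∸-cancelʳ-≡ (proj₁ (value-bounds k)) (proj₁ (value-bounds k'))
        (trans (sym (Finₚ.toℕ-fromℕ< _)) (trans (cong toℕ e) (Finₚ.toℕ-fromℕ< _)))

  ⟨$⟩ʳ-injective : ∀ {n} (w : Permutation′ n) → Injective _≡_ _≡_ (w ⟨$⟩ʳ_)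
  ⟨$⟩ʳ-injective w e = trans (sym (inverseˡ w)) (trans (cong (w ⟨$⟩ˡ_) e) (inverseˡ w))

  lo hi : ℕ × ℕ → ℕ
  lo (h , j) = h
  hi (h , j) = h + j

  lo≤hi : ∀ I → lo I ≤ hi I
  lo≤hi (h , j) = m≤m+n h j

  module _ {n : ℕ} (w : Permutation′ n) where

    -- The values [l, u] occupy exactly the positions [first, last].
    record Block (l u : ℕ) : Set where
      field
        first last : ℕ
        l≤u        : l ≤ u
        u<n        : u < n
        first≤last : first ≤ last
        last<n     : last < n
        onto       : ∀ v → toℕ v ∈[ l , u ] →
                     Σ (Fin n) λ t → (first ≤ toℕ t) × (toℕ t ≤ last) × (w ⟨$⟩ʳ t ≡ v)
        into       : ∀ t → toℕ t ∈[ first , last ] → toℕ (w ⟨$⟩ʳ t) ∈[ l , u ]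

    IsInterval⇒Block : ∀ {I} → IsInterval w I → Block (lo I) (hi I)
    IsInterval⇒Block {h , j} (h+j<n , i , i+j<n , h∈⇔) = record
      { first = i ; last = i + j ; l≤u = m≤m+n h j ; u<n = h+j<n ; first≤last = m≤m+n i j ; last<n = i+j<n
      ; onto  = λ v v∈ → Equivalence.to (h∈⇔ v) v∈
      ; into  = λ t (first≤t , t≤last) → Equivalence.from (h∈⇔ (w ⟨$⟩ʳ t)) (t , first≤t , t≤last , refl) }

    Block⇒IsInterval : ∀ {l u} → Block l u → IsInterval w (l , u ∸ l)
    Block⇒IsInterval {l} {u} B =
      subst (_< n) (sym l+len≡u) u<n , first , subst (_< n) (sym first+len≡last) last<n ,
      λ v → mk⇔ (λ (l≤v , v≤) → let (t , first≤t , t≤last , wt≡v) = onto v (l≤v , subst (toℕ v ≤_) l+len≡u v≤)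
                                 in t , first≤t , subst (toℕ t ≤_) (sym first+len≡last) t≤last , wt≡v)
                (λ { (t , first≤t , t≤ , refl) →
                       let (l≤wt , wt≤u) = into t (first≤t , subst (toℕ t ≤_) first+len≡last t≤)
                       in l≤wt , subst (toℕ (w ⟨$⟩ʳ t) ≤_) (sym l+len≡u) wt≤u })
      where
      open Block B
      l+len≡u : l + (u ∸ l) ≡ u
      l+len≡u = m+[n∸m]≡n l≤u
      preimage-in-block : ∀ v → toℕ v ∈[ l , u ] → toℕ (w ⟨$⟩ˡ v) ∈[ first , last ]
      preimage-in-block v v∈ with onto v v∈
      ... | t , first≤t , t≤last , refl = subst (λ s → toℕ s ∈[ first , last ]) (sym (inverseˡ w)) (first≤t , t≤last)
      first+len≡last : first + (u ∸ l) ≡ last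
      first+len≡last = trans (cong (first +_) (≤-antisym
        (injective⇒range-length-≤ (flip w ⟨$⟩ʳ_) (⟨$⟩ʳ-injective (flip w)) l≤u u<n preimage-in-block)
        (injective⇒range-length-≤ (w ⟨$⟩ʳ_) (⟨$⟩ʳ-injective w) first≤last last<n into)))
        (m+[n∸m]≡n first≤last)

  ⊓≤⇒≤ʳ : ∀ {l l' x} → l ⊓ l' ≤ x → x < l → l' ≤ x
  ⊓≤⇒≤ʳ {l} {l'} {x} l⊓l'≤x x<l with ⊓-sel l l'
  ... | inj₁ l⊓l'≡l  = ⊥-elim (<⇒≱ x<l (subst (_≤ x) l⊓l'≡l l⊓l'≤x))
  ... | inj₂ l⊓l'≡l' = subst (_≤ x) l⊓l'≡l' l⊓l'≤x

  ≤⊔⇒≤ʳ : ∀ {u u' x} → x ≤ u ⊔ u' → u < x → x ≤ u'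
  ≤⊔⇒≤ʳ {u} {u'} {x} x≤u⊔u' u<x with ⊔-sel u u'
  ... | inj₁ u⊔u'≡u  = ⊥-elim (<⇒≱ u<x (subst (x ≤_) u⊔u'≡u x≤u⊔u'))
  ... | inj₂ u⊔u'≡u' = subst (x ≤_) u⊔u'≡u' x≤u⊔u'

  ⊔-sel≡ : ∀ {m k x} → m ⊔ k ≡ x → x ≡ m ⊎ x ≡ k
  ⊔-sel≡ {m} {k} refl = ⊔-sel m k

  ⊓-sel≡ : ∀ {m k x} → m ⊓ k ≡ x → x ≡ m ⊎ x ≡ k
  ⊓-sel≡ {m} {k} refl = ⊓-sel m k

  ∈-⊓⊔-split : ∀ {l u l' u' x} → l ≤ u' → l' ≤ u → x ∈[ l ⊓ l' , u ⊔ u' ] → x ∈[ l , u ] ⊎ x ∈[ l' , u' ]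
  ∈-⊓⊔-split {l} {u} {l'} {u'} {x} l≤u' l'≤u (lo≤x , x≤hi) with l ≤? x | x ≤? u
  ... | yes l≤x | yes x≤u = inj₁ (l≤x , x≤u)
  ... | yes _   | no  x≰u = inj₂ (≤-trans l'≤u (<⇒≤ (≰⇒> x≰u)) , ≤⊔⇒≤ʳ x≤hi (≰⇒> x≰u))
  ... | no  l≰x | _       = inj₂ (⊓≤⇒≤ʳ lo≤x (≰⇒> l≰x) , ≤-trans (<⇒≤ (≰⇒> l≰x)) l≤u')

  module _ {n : ℕ} {w : Permutation′ n} {l u l' u' : ℕ} (B : Block w l u) (B' : Block w l' u')
           (l≤u' : l ≤ u') (l'≤u : l' ≤ u) where
    private
      module B  = Block B
      module B' = Block B'

      common : Fin n
      common = fromℕ< (≤-<-trans (⊔-lub B.l≤u l'≤u) B.u<n)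

      common∈ : toℕ common ∈[ l ⊔ l' , u ⊓ u' ]
      common∈ = subst (_∈[ l ⊔ l' , u ⊓ u' ]) (sym (Finₚ.toℕ-fromℕ< _))
                  (≤-refl , ⊔-lub (⊓-glb B.l≤u l≤u') (⊓-glb l'≤u B'.l≤u))

      onto-∩ : ∀ v → toℕ v ∈[ l ⊔ l' , u ⊓ u' ] →
               Σ (Fin n) λ t → (B.first ⊔ B'.first ≤ toℕ t) × (toℕ t ≤ B.last ⊓ B'.last) × (w ⟨$⟩ʳ t ≡ v)
      onto-∩ v (l⊔l'≤v , v≤u⊓u')
        with B.onto v (≤-trans (m≤m⊔n l l') l⊔l'≤v , ≤-trans v≤u⊓u' (m⊓n≤m u u'))
           | B'.onto v (≤-trans (m≤n⊔m l l') l⊔l'≤v , ≤-trans v≤u⊓u' (m⊓n≤n u u'))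
      ... | t , first≤t , t≤last , wt≡v | t' , first'≤t' , t'≤last' , wt'≡v
        with ⟨$⟩ʳ-injective w (trans wt≡v (sym wt'≡v))
      ... | refl = t , ⊔-lub first≤t first'≤t' , ⊓-glb t≤last t'≤last' , wt≡v

      positions-overlap : B.first ⊔ B'.first ≤ B.last ⊓ B'.last
      positions-overlap = let (_ , first≤t , t≤last , _) = onto-∩ common common∈ in ≤-trans first≤t t≤last

      first≤last' : B.first ≤ B'.last
      first≤last' = ≤-trans (m≤m⊔n _ _) (≤-trans positions-overlap (m⊓n≤n _ _))

      first'≤last : B'.first ≤ B.last
      first'≤last = ≤-trans (m≤n⊔m _ _) (≤-trans positions-overlap (m⊓n≤m _ _))

    Block-∪ : Block w (l ⊓ l') (u ⊔ u')
    Block-∪ = record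
      { first = B.first ⊓ B'.first ; last = B.last ⊔ B'.last
      ; l≤u = ≤-trans (m⊓n≤m l l') (≤-trans B.l≤u (m≤m⊔n u u'))
      ; u<n = ⊔-lub B.u<n B'.u<n
      ; first≤last = ≤-trans (m⊓n≤m _ _) (≤-trans B.first≤last (m≤m⊔n _ _))
      ; last<n = ⊔-lub B.last<n B'.last<n
      ; onto = onto ; into = into }
      where
      onto : ∀ v → toℕ v ∈[ l ⊓ l' , u ⊔ u' ] →
             Σ (Fin n) λ t → (B.first ⊓ B'.first ≤ toℕ t) × (toℕ t ≤ B.last ⊔ B'.last) × (w ⟨$⟩ʳ t ≡ v)
      onto v v∈ with ∈-⊓⊔-split l≤u' l'≤u v∈
      ... | inj₁ v∈B  = let (t , first≤t , t≤last , wt≡v) = B.onto v v∈B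
                        in t , ≤-trans (m⊓n≤m _ _) first≤t , ≤-trans t≤last (m≤m⊔n _ _) , wt≡v
      ... | inj₂ v∈B' = let (t , first≤t , t≤last , wt≡v) = B'.onto v v∈B'
                        in t , ≤-trans (m⊓n≤n _ _) first≤t , ≤-trans t≤last (m≤n⊔m _ _) , wt≡v
      into : ∀ t → toℕ t ∈[ B.first ⊓ B'.first , B.last ⊔ B'.last ] → toℕ (w ⟨$⟩ʳ t) ∈[ l ⊓ l' , u ⊔ u' ]
      into t t∈ with ∈-⊓⊔-split first≤last' first'≤last t∈
      ... | inj₁ t∈B  = let (l≤wt , wt≤u) = B.into t t∈B in ≤-trans (m⊓n≤m _ _) l≤wt , ≤-trans wt≤u (m≤m⊔n _ _)
      ... | inj₂ t∈B' = let (l≤wt , wt≤u) = B'.into t t∈B' in ≤-trans (m⊓n≤n _ _) l≤wt , ≤-trans wt≤u (m≤n⊔m _ _)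

    Block-∩ : Block w (l ⊔ l') (u ⊓ u')
    Block-∩ = record
      { first = B.first ⊔ B'.first ; last = B.last ⊓ B'.last
      ; l≤u = ⊔-lub (⊓-glb B.l≤u l≤u') (⊓-glb l'≤u B'.l≤u)
      ; u<n = ≤-<-trans (m⊓n≤m u u') B.u<n
      ; first≤last = positions-overlap
      ; last<n = ≤-<-trans (m⊓n≤m _ _) B.last<n
      ; onto = onto-∩ ; into = into }
      where
      into : ∀ t → toℕ t ∈[ B.first ⊔ B'.first , B.last ⊓ B'.last ] → toℕ (w ⟨$⟩ʳ t) ∈[ l ⊔ l' , u ⊓ u' ]
      into t (first≤t , t≤last) =
        let (l≤wt , wt≤u) = B.into t (≤-trans (m≤m⊔n _ _) first≤t , ≤-trans t≤last (m⊓n≤m _ _))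
            (l'≤wt , wt≤u') = B'.into t (≤-trans (m≤n⊔m _ _) first≤t , ≤-trans t≤last (m⊓n≤n _ _))
        in ⊔-lub l≤wt l'≤wt , ⊓-glb wt≤u wt≤u'

  singleton-block : ∀ {n} (w : Permutation′ n) {h} → h < n → Block w h h
  singleton-block {n} w {h} h<n = record
    { first = toℕ t₀ ; last = toℕ t₀ ; l≤u = ≤-refl ; u<n = h<n ; first≤last = ≤-refl ; last<n = Finₚ.toℕ<n t₀
    ; onto = onto ; into = into }
    where
    v₀ : Fin n
    v₀ = fromℕ< h<n
    t₀ : Fin n
    t₀ = w ⟨$⟩ˡ v₀
    onto : ∀ v → toℕ v ∈[ h , h ] → Σ (Fin n) λ t → (toℕ t₀ ≤ toℕ t) × (toℕ t ≤ toℕ t₀) × (w ⟨$⟩ʳ t ≡ v)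
    onto v (h≤v , v≤h) with Finₚ.toℕ-injective {i = v} {v₀} (trans (≤-antisym v≤h h≤v) (sym (Finₚ.toℕ-fromℕ< h<n)))
    ... | refl = t₀ , ≤-refl , ≤-refl , inverseʳ w
    into : ∀ t → toℕ t ∈[ toℕ t₀ , toℕ t₀ ] → toℕ (w ⟨$⟩ʳ t) ∈[ h , h ]
    into t (t₀≤t , t≤t₀) with Finₚ.toℕ-injective {i = t} {t₀} (≤-antisym t≤t₀ t₀≤t)
    ... | refl = subst (_∈[ h , h ]) (sym (trans (cong toℕ (inverseʳ w)) (Finₚ.toℕ-fromℕ< h<n))) (≤-refl , ≤-refl)

  span : ℕ → ℕ → ℕ × ℕ
  span l u = l , u ∸ l

  hi-span : ∀ {l u} → l ≤ u → hi (span l u) ≡ u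
  hi-span = m+[n∸m]≡n

  span-≡ : ∀ {l u I} → l ≤ u → span l u ≡ I → (l ≡ lo I) × (u ≡ hi I)
  span-≡ l≤u refl = refl , sym (hi-span l≤u)

  ⊑-span : ∀ {I l u} → l ≤ u → l ≤ lo I → hi I ≤ u → I ⊑ span l u
  ⊑-span l≤u l≤lo hi≤u = l≤lo , subst (_ ≤_) (sym (hi-span l≤u)) hi≤u

  span-⊑ : ∀ {I l u} → l ≤ u → lo I ≤ l → u ≤ hi I → span l u ⊑ I
  span-⊑ l≤u lo≤l u≤hi = lo≤l , subst (_≤ _) (sym (hi-span l≤u)) u≤hi
  module _ {n : ℕ} (w : Permutation′ n) where

    ∪-interval : ∀ {I I'} → IsInterval w I → IsInterval w I' → lo I ≤ hi I' → lo I' ≤ hi I →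
                 IsInterval w (span (lo I ⊓ lo I') (hi I ⊔ hi I'))
    ∪-interval I-int I'-int lo≤hi' lo'≤hi =
      Block⇒IsInterval w (Block-∪ (IsInterval⇒Block w I-int) (IsInterval⇒Block w I'-int) lo≤hi' lo'≤hi)

    ∩-interval : ∀ {I I'} → IsInterval w I → IsInterval w I' → lo I ≤ hi I' → lo I' ≤ hi I →
                 IsInterval w (span (lo I ⊔ lo I') (hi I ⊓ hi I'))
    ∩-interval I-int I'-int lo≤hi' lo'≤hi =
      Block⇒IsInterval w (Block-∩ (IsInterval⇒Block w I-int) (IsInterval⇒Block w I'-int) lo≤hi' lo'≤hi)

    singleton-interval : ∀ {h} → h < n → IsInterval w (h , 0)
    singleton-interval {h} h<n =
      subst (λ j → IsInterval w (h , j)) (n∸n≡0 h) (Block⇒IsInterval w (singleton-block w h<n))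

module Drawing where

  open import Defs
  open Plane
  open Intervals
  open import Data.Nat using (ℕ; zero; suc; z≤n; _+_; _≤_; _<_; _⊔_; _⊓_; _≤?_)
  open import Data.Nat.Properties
  open import Data.Product using (Σ; _×_; _,_; proj₁; proj₂)
  open import Data.Sum using (_⊎_; inj₁; inj₂)
  import Data.Sum as Sum
  open import Data.Maybe using (Maybe; just; nothing)
  open import Data.Maybe.Properties using (just-injective)
  open import Data.Unit using (tt)
  open import Data.Empty using (⊥-elim)
  open import Relation.Binary.PropositionalEquality
  open import Relation.Nullary using (¬_; yes; no)
  open import Data.Fin.Permutation using (Permutation′)
  open import Data.Rational as ℚ using (ℚ; 0ℚ; 1ℚ)
  import Data.Rational.Properties as ℚₚ
  open import Data.Rational.Solver using (module +-*-Solver)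
  open +-*-Solver using (solve; _:+_; _:-_; _:*_; con; _:=_)

  -- The interval [h, h + j] is drawn at (h, j). Going up an edge I ⋖ J the left end x falls
  -- from lo I to lo J and the right end x + y rises from hi I to hi J; InBox records this.
  point : ℕ × ℕ → Point
  point (h , j) = fromℕ h , fromℕ j

  vcoord : Point → ℚ
  vcoord (x , y) = x ℚ.+ y

  vcoord-point : ∀ I → vcoord (point I) ≡ fromℕ (hi I)
  vcoord-point (h , j) = sym (fromℕ-+ h j)

  point-injective : ∀ {I J} → point I ≡ point J → I ≡ J
  point-injective {h , j} {h' , j'} e = cong₂ _,_ (fromℕ-injective (cong proj₁ e)) (fromℕ-injective (cong proj₂ e))

  point-from-coords : ∀ {q} K → proj₁ q ≡ fromℕ (lo K) → vcoord q ≡ fromℕ (hi K) → q ≡ point K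
  point-from-coords {x , y} (h , j) x≡h x+y≡h+j = cong₂ _,_ x≡h (begin
    y                     ≡⟨ solve 2 (λ x y → y := (x :+ y) :- x) refl x y ⟩
    (x ℚ.+ y) ℚ.- x       ≡⟨ cong₂ ℚ._-_ (trans x+y≡h+j (fromℕ-+ h j)) x≡h ⟩
    (fromℕ h ℚ.+ fromℕ j) ℚ.- fromℕ h ≡⟨ solve 2 (λ h j → (h :+ j) :- h := j) refl (fromℕ h) (fromℕ j) ⟩
    fromℕ j               ∎)
    where open ≡-Reasoning

  record InBox (q : Point) (I J : ℕ × ℕ) : Set where
    field
      x-lower : fromℕ (lo J) ℚ.≤ proj₁ q
      x-upper : proj₁ q ℚ.≤ fromℕ (lo I)
      v-lower : fromℕ (hi I) ℚ.≤ vcoord q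
      v-upper : vcoord q ℚ.≤ fromℕ (hi J)
  open InBox

  segment-in-box : ∀ {q I J} → I ⊑ J → OnSegment q (point I) (point J) → InBox q I J
  segment-in-box {I = h , j} {h' , j'} (h'≤h , h+j≤h'+j') (t , 0≤t , t≤1 , refl) = record
    { x-lower = proj₁ (lerp-between-rev (0≤t , t≤1) (fromℕ-mono-≤ h'≤h))
    ; x-upper = proj₂ (lerp-between-rev (0≤t , t≤1) (fromℕ-mono-≤ h'≤h))
    ; v-lower = subst (_ ℚ.≤_) (sym v≡) (proj₁ v-between)
    ; v-upper = subst (ℚ._≤ _) (sym v≡) (proj₂ v-between) }
    where
    v-between : (fromℕ (h + j) ℚ.≤ lerp t (fromℕ (h + j)) (fromℕ (h' + j'))) ×
                (lerp t (fromℕ (h + j)) (fromℕ (h' + j')) ℚ.≤ fromℕ (h' + j'))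
    v-between = lerp-between (0≤t , t≤1) (fromℕ-mono-≤ h+j≤h'+j')
    v≡ : lerp t (fromℕ h) (fromℕ h') ℚ.+ lerp t (fromℕ j) (fromℕ j') ≡ lerp t (fromℕ (h + j)) (fromℕ (h' + j'))
    v≡ rewrite fromℕ-+ h j | fromℕ-+ h' j' =
      solve 5 (λ t h h' j j' → (h :+ t :* (h' :- h)) :+ (j :+ t :* (j' :- j)) := (h :+ j) :+ t :* ((h' :+ j') :- (h :+ j)))
        refl t (fromℕ h) (fromℕ h') (fromℕ j) (fromℕ j')

  point-in-box : ∀ K → InBox (point K) K K
  point-in-box K = record
    { x-lower = ℚₚ.≤-refl ; x-upper = ℚₚ.≤-refl
    ; v-lower = ℚₚ.≤-reflexive (sym (vcoord-point K)) ; v-upper = ℚₚ.≤-reflexive (vcoord-point K) }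

  boxes-⊑ : ∀ {q I J I' J'} → InBox q I J → InBox q I' J' → I ⊑ J'
  boxes-⊑ B B' = fromℕ-cancel-≤ (ℚₚ.≤-trans (x-lower B') (x-upper B)) ,
                 fromℕ-cancel-≤ (ℚₚ.≤-trans (v-lower B) (v-upper B'))

  pinned : ∀ {q I J I' J'} → InBox q I J → InBox q I' J' → ∀ K →
           (lo K ≡ lo J ⊎ lo K ≡ lo J') → (lo K ≡ lo I ⊎ lo K ≡ lo I') →
           (hi K ≡ hi I ⊎ hi K ≡ hi I') → (hi K ≡ hi J ⊎ hi K ≡ hi J') → q ≡ point K
  pinned B B' K x-low x-up v-low v-up = point-from-coords K
    (ℚₚ.≤-antisym (squeeze-upper x-up (x-upper B) (x-upper B')) (squeeze-lower x-low (x-lower B) (x-lower B')))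
    (ℚₚ.≤-antisym (squeeze-upper v-up (v-upper B) (v-upper B')) (squeeze-lower v-low (v-lower B) (v-lower B')))
    where
    squeeze-lower : ∀ {k a b r} → k ≡ a ⊎ k ≡ b → fromℕ a ℚ.≤ r → fromℕ b ℚ.≤ r → fromℕ k ℚ.≤ r
    squeeze-lower (inj₁ refl) a≤r _ = a≤r
    squeeze-lower (inj₂ refl) _ b≤r = b≤r
    squeeze-upper : ∀ {k a b r} → k ≡ a ⊎ k ≡ b → r ℚ.≤ fromℕ a → r ℚ.≤ fromℕ b → r ℚ.≤ fromℕ k
    squeeze-upper (inj₁ refl) r≤a _ = r≤a
    squeeze-upper (inj₂ refl) _ r≤b = r≤b

  orientation-disjoint : ∀ {I I' J} → I ⊑ J → I' ⊑ J → hi I < lo I' →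
                         orientation (point J) (point I) (point I') ≢ 0ℚ
  orientation-disjoint {h₁ , j₁} {h₃ , j₃} {h₂ , j₂} (h₂≤h₁ , _) (_ , hi'≤hi₂) hi<lo' Δ≡0 =
    p≢q⇒p-q≢0 (≢-sym (ℚₚ.<⇒≢ cross)) (trans (sym expand) Δ≡0)
    where
    ι : ℕ → ℚ
    ι = fromℕ
    X X' Y Y' : ℚ
    X  = ι h₁ ℚ.- ι h₂
    X' = ι h₃ ℚ.- ι h₂
    Y  = (ι h₂ ℚ.+ ι j₂) ℚ.- (ι h₁ ℚ.+ ι j₁)
    Y' = (ι h₂ ℚ.+ ι j₂) ℚ.- (ι h₃ ℚ.+ ι j₃)
    expand : orientation (point (h₂ , j₂)) (point (h₁ , j₁)) (point (h₃ , j₃)) ≡ X' ℚ.* Y ℚ.- X ℚ.* Y'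
    expand = solve 6 (λ h₁ j₁ h₂ j₂ h₃ j₃ →
               (h₁ :- h₂) :* (j₃ :- j₂) :- (j₁ :- j₂) :* (h₃ :- h₂) :=
               (h₃ :- h₂) :* ((h₂ :+ j₂) :- (h₁ :+ j₁)) :- (h₁ :- h₂) :* ((h₂ :+ j₂) :- (h₃ :+ j₃)))
               refl (ι h₁) (ι j₁) (ι h₂) (ι j₂) (ι h₃) (ι j₃)
    ι-hi-< : ι h₁ ℚ.+ ι j₁ ℚ.< ι h₃ ℚ.+ ι j₃
    ι-hi-< = subst₂ ℚ._<_ (fromℕ-+ h₁ j₁) (fromℕ-+ h₃ j₃) (fromℕ-mono-< (<-≤-trans hi<lo' (m≤m+n h₃ j₃)))
    cross : X ℚ.* Y' ℚ.< X' ℚ.* Y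
    cross = *-cross-< (p≤q⇒0≤q-p (fromℕ-mono-≤ h₂≤h₁))
                      (ℚₚ.+-monoˡ-< (ℚ.- ι h₂) (fromℕ-mono-< (≤-<-trans (m≤m+n h₁ j₁) hi<lo')))
                      (p≤q⇒0≤q-p (subst₂ ℚ._≤_ (fromℕ-+ h₃ j₃) (fromℕ-+ h₂ j₂) (fromℕ-mono-≤ hi'≤hi₂)))
                      (ℚₚ.+-monoʳ-< (ι h₂ ℚ.+ ι j₂) (ℚₚ.neg-antimono-< ι-hi-<))

  SharedEndpoint : {X : Set} → (X → Point) → X → X → X → X → Point → Set
  SharedEndpoint {X} p x y x' y' q = Σ X λ z → ((z ≡ x) ⊎ (z ≡ y)) × ((z ≡ x') ⊎ (z ≡ y')) × (q ≡ p z)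

  module _ {n : ℕ} (w : Permutation′ n) where

    _⋖_ : ℕ × ℕ → ℕ × ℕ → Set
    _⋖_ = Covers (IsInterval w) _⊑_

    ⋖⇒⊑ : ∀ {I J} → I ⋖ J → I ⊑ J
    ⋖⇒⊑ (_ , _ , I⊑J , _) = I⊑J

    ⋖-between : ∀ {I J K} → I ⋖ J → IsInterval w K → I ⊑ K → K ⊑ J → K ≡ I ⊎ K ≡ J
    ⋖-between (_ , _ , _ , _ , maximal) = maximal _

    ⋖⇒len< : ∀ {I J} → I ⋖ J → proj₂ I < proj₂ J
    ⋖⇒len< {h , j} {h' , j'} (_ , _ , (h'≤h , h+j≤h'+j') , I≢J , _) =
      ≤∧≢⇒< (+-cancelˡ-≤ h j j' (≤-trans h+j≤h'+j' (+-monoˡ-≤ j' h'≤h)))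
            (λ { refl → I≢J (cong (_, j) (≤-antisym (+-cancelʳ-≤ j h h' h+j≤h'+j') h'≤h)) })

    vertex-on-edge : ∀ {I J K} → I ⋖ J → IsInterval w K → OnSegment (point K) (point I) (point J) → K ≡ I ⊎ K ≡ J
    vertex-on-edge {I} {J} {K} I⋖J@(_ , _ , I⊑J , _) K-int s =
      ⋖-between I⋖J K-int (boxes-⊑ box (point-in-box K)) (boxes-⊑ (point-in-box K) box)
      where
      box : InBox (point K) I J
      box = segment-in-box I⊑J s

    overlapping-edges-meet-at-top : ∀ {q I I' J} → I ⋖ J → I' ⋖ J → I ≢ I' → lo I' ≤ hi I → lo I ≤ hi I' →
                                    OnSegment q (point I) (point J) → OnSegment q (point I') (point J) → q ≡ point J
    overlapping-edges-meet-at-top {q} {I} {I'} {J} I⋖J@(I-int , _ , I⊑J , I≢J , _) I'⋖J@(I'-int , _ , I'⊑J , I'≢J , _)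
                                  I≢I' lo'≤hi lo≤hi' s s' =
      by-union (⋖-between I⋖J M-int I⊑M M⊑J) (⋖-between I'⋖J M-int I'⊑M M⊑J)
      where
      M : ℕ × ℕ
      M = span (lo I ⊓ lo I') (hi I ⊔ hi I')
      M-int : IsInterval w M
      M-int = ∪-interval w I-int I'-int lo≤hi' lo'≤hi
      l≤u : lo I ⊓ lo I' ≤ hi I ⊔ hi I'
      l≤u = ≤-trans (m⊓n≤m _ _) (≤-trans (lo≤hi I) (m≤m⊔n _ _))
      I⊑M : I ⊑ M
      I⊑M = ⊑-span l≤u (m⊓n≤m _ _) (m≤m⊔n _ _)
      I'⊑M : I' ⊑ M
      I'⊑M = ⊑-span l≤u (m⊓n≤n _ _) (m≤n⊔m _ _)
      M⊑J : M ⊑ J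
      M⊑J = span-⊑ l≤u (⊓-glb (proj₁ I⊑J) (proj₁ I'⊑J)) (⊔-lub (proj₂ I⊑J) (proj₂ I'⊑J))
      by-union : M ≡ I ⊎ M ≡ J → M ≡ I' ⊎ M ≡ J → q ≡ point J
      by-union (inj₁ M≡I) (inj₁ M≡I') = ⊥-elim (I≢I' (trans (sym M≡I) M≡I'))
      by-union (inj₁ M≡I) (inj₂ M≡J)  = ⊥-elim (I≢J (trans (sym M≡I) M≡J))
      by-union (inj₂ M≡J) (inj₁ M≡I') = ⊥-elim (I'≢J (trans (sym M≡I') M≡J))
      by-union (inj₂ M≡J) (inj₂ _)    =
        pinned (segment-in-box I⊑J s) (segment-in-box I'⊑J s') J
          (inj₁ refl) (⊓-sel≡ (proj₁ (span-≡ l≤u M≡J))) (⊔-sel≡ (proj₂ (span-≡ l≤u M≡J))) (inj₁ refl)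

    edges-into-common-top-meet-at-top : ∀ {q I I' J} → I ⋖ J → I' ⋖ J → I ≢ I' →
                                        OnSegment q (point I) (point J) → OnSegment q (point I') (point J) → q ≡ point J
    edges-into-common-top-meet-at-top {I = I} {I'} {J} I⋖J I'⋖J I≢I' s s' with lo I' ≤? hi I | lo I ≤? hi I'
    ... | no lo'≰hi | _ = segments-into-common-end (point I) (point I') (point J)
                            (orientation-disjoint (⋖⇒⊑ I⋖J) (⋖⇒⊑ I'⋖J) (≰⇒> lo'≰hi)) s s'
    ... | yes _ | no lo≰hi' = segments-into-common-end (point I') (point I) (point J)
                            (orientation-disjoint (⋖⇒⊑ I'⋖J) (⋖⇒⊑ I⋖J) (≰⇒> lo≰hi')) s' s
    ... | yes lo'≤hi | yes lo≤hi' = overlapping-edges-meet-at-top I⋖J I'⋖J I≢I' lo'≤hi lo≤hi' s s'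

    edges-meet-at-endpoint : ∀ {q I J I' J'} → I ⋖ J → I' ⋖ J' → ¬ ((I ≡ I') × (J ≡ J')) →
                             OnSegment q (point I) (point J) → OnSegment q (point I') (point J') →
                             SharedEndpoint point I J I' J' q
    edges-meet-at-endpoint {q} {I} {J} {I'} {J'} I⋖J@(_ , J-int , I⊑J , _) I'⋖J'@(_ , J'-int , I'⊑J' , _) distinct s s' =
      by-intersection (⋖-between I⋖J K-int I⊑K K⊑J) (⋖-between I'⋖J' K-int I'⊑K K⊑J')
      where
      box : InBox q I J
      box = segment-in-box I⊑J s
      box' : InBox q I' J'
      box' = segment-in-box I'⊑J' s'
      I⊑J' : I ⊑ J'
      I⊑J' = boxes-⊑ box box'
      I'⊑J : I' ⊑ J
      I'⊑J = boxes-⊑ box' box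
      lo≤hi' : lo J ≤ hi J'
      lo≤hi' = ≤-trans (proj₁ I'⊑J) (≤-trans (lo≤hi I') (proj₂ I'⊑J'))
      lo'≤hi : lo J' ≤ hi J
      lo'≤hi = ≤-trans (proj₁ I⊑J') (≤-trans (lo≤hi I) (proj₂ I⊑J))
      K : ℕ × ℕ
      K = span (lo J ⊔ lo J') (hi J ⊓ hi J')
      K-int : IsInterval w K
      K-int = ∩-interval w J-int J'-int lo≤hi' lo'≤hi
      l≤u : lo J ⊔ lo J' ≤ hi J ⊓ hi J'
      l≤u = ⊔-lub (⊓-glb (lo≤hi J) lo≤hi') (⊓-glb lo'≤hi (lo≤hi J'))
      I⊑K : I ⊑ K
      I⊑K = ⊑-span l≤u (⊔-lub (proj₁ I⊑J) (proj₁ I⊑J')) (⊓-glb (proj₂ I⊑J) (proj₂ I⊑J'))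
      I'⊑K : I' ⊑ K
      I'⊑K = ⊑-span l≤u (⊔-lub (proj₁ I'⊑J) (proj₁ I'⊑J')) (⊓-glb (proj₂ I'⊑J) (proj₂ I'⊑J'))
      K⊑J : K ⊑ J
      K⊑J = span-⊑ l≤u (m≤m⊔n _ _) (m⊓n≤m _ _)
      K⊑J' : K ⊑ J'
      K⊑J' = span-⊑ l≤u (m≤n⊔m _ _) (m⊓n≤n _ _)
      by-intersection : K ≡ I ⊎ K ≡ J → K ≡ I' ⊎ K ≡ J' → SharedEndpoint point I J I' J' q
      by-intersection (inj₁ K≡I) (inj₁ K≡I') =
        I , inj₁ refl , inj₁ (trans (sym K≡I) K≡I') ,
        pinned box box' I (⊔-sel≡ (proj₁ (span-≡ l≤u K≡I))) (inj₁ refl) (inj₁ refl) (⊓-sel≡ (proj₂ (span-≡ l≤u K≡I)))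
      by-intersection (inj₁ K≡I) (inj₂ K≡J') =
        I , inj₁ refl , inj₂ I≡J' , pinned box box' I (inj₂ (cong lo I≡J')) (inj₁ refl) (inj₁ refl) (inj₂ (cong hi I≡J'))
        where I≡J' = trans (sym K≡I) K≡J'
      by-intersection (inj₂ K≡J) (inj₁ K≡I') =
        I' , inj₂ I'≡J , inj₁ refl , pinned box box' I' (inj₁ (cong lo I'≡J)) (inj₂ refl) (inj₂ refl) (inj₁ (cong hi I'≡J))
        where I'≡J = trans (sym K≡I') K≡J
      by-intersection (inj₂ K≡J) (inj₂ K≡J') =
        J , inj₂ refl , inj₂ J≡J' ,
        edges-into-common-top-meet-at-top I⋖J (subst (I' ⋖_) (sym J≡J') I'⋖J') (λ I≡I' → distinct (I≡I' , J≡J'))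
          s (subst (λ X → OnSegment q (point I') (point X)) (sym J≡J') s')
        where J≡J' = trans (sym K≡J) K≡J'

    interval-poset-planar : Planar (IsInterval w) _⊑_
    interval-poset-planar =
      point ,
      (λ _ _ _ _ → point-injective) ,
      (λ _ _ I⋖J → fromℕ-mono-< (⋖⇒len< I⋖J)) ,
      (λ _ _ _ I⋖J K-int s → vertex-on-edge I⋖J K-int s) ,
      (λ _ _ _ _ I⋖J I'⋖J' distinct q → edges-meet-at-endpoint {q} I⋖J I'⋖J' distinct)

    edge-above-source : ∀ {q I J} → I ⋖ J → OnSegment q (point I) (point J) → fromℕ (proj₂ I) ℚ.≤ proj₂ q
    edge-above-source {I = h , j} {h' , j'} I⋖J (t , 0≤t , t≤1 , refl) =
      proj₁ (lerp-between (0≤t , t≤1) (fromℕ-mono-≤ (<⇒≤ (⋖⇒len< I⋖J))))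

    _⋖̄_ : Maybe (ℕ × ℕ) → Maybe (ℕ × ℕ) → Set
    _⋖̄_ = Covers (IsIntervalBar w) _⊑̄_

    just-⋖̄ : ∀ {I J} → just I ⋖̄ just J → I ⋖ J
    just-⋖̄ (I-int , J-int , I⊑J , I≢J , maximal) =
      I-int , J-int , I⊑J , (λ I≡J → I≢J (cong just I≡J)) ,
      λ K K-int I⊑K K⊑J → Sum.map just-injective just-injective (maximal (just K) K-int I⊑K K⊑J)

    ⋖̄-nothing : ∀ {x} → ¬ (x ⋖̄ nothing)
    ⋖̄-nothing {nothing} (_ , _ , _ , x≢x , _) = x≢x refl
    ⋖̄-nothing {just _}  (_ , _ , () , _)

    nothing-⋖̄ : ∀ {h j} → nothing ⋖̄ just (h , j) → j ≡ 0
    nothing-⋖̄ {h} {zero}  _ = refl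
    nothing-⋖̄ {h} {suc j} (_ , (h+j<n , _) , _ , _ , maximal) =
      not-covered (maximal (just (h , 0)) (singleton-interval w h<n) tt (≤-refl , +-monoʳ-≤ h z≤n))
      where
      h<n : h < n
      h<n = ≤-<-trans (m≤m+n h (suc j)) h+j<n
      not-covered : (just (h , 0) ≡ nothing) ⊎ (just (h , 0) ≡ just (h , suc j)) → suc j ≡ 0
      not-covered (inj₁ ())
      not-covered (inj₂ ())

    bottom : Point
    bottom = 0ℚ , ℚ.- 1ℚ

    point̄ : Maybe (ℕ × ℕ) → Point
    point̄ nothing  = bottom
    point̄ (just I) = point I

    bottom-below : ∀ j → proj₂ bottom ℚ.< fromℕ j
    bottom-below j = ℚₚ.<-≤-trans (ℚₚ.neg-antimono-< (ℚₚ.positive⁻¹ 1ℚ)) (fromℕ-nonNeg j)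

    atom-edges-meet-at-bottom : ∀ {q h j h' j'} → j ≡ 0 → j' ≡ 0 → (h , j) ≢ (h' , j') →
                                OnSegment q bottom (point (h , j)) → OnSegment q bottom (point (h' , j')) → q ≡ bottom
    atom-edges-meet-at-bottom {q} {h} {h' = h'} refl refl A≢A' s s' =
      segments-into-common-end (point (h , 0)) (point (h' , 0)) bottom Δ≢0
        (OnSegment-sym bottom (point (h , 0)) s) (OnSegment-sym bottom (point (h' , 0)) s')
      where
      Δ≢0 : orientation bottom (point (h , 0)) (point (h' , 0)) ≢ 0ℚ
      Δ≢0 Δ≡0 = p≢q⇒p-q≢0 (λ ιh≡ιh' → A≢A' (cong (_, 0) (fromℕ-injective ιh≡ιh')))
        (trans (solve 2 (λ x x' → x :- x' :=
                  (x :- con 0ℚ) :* (con 0ℚ :- con (ℚ.- 1ℚ)) :- (con 0ℚ :- con (ℚ.- 1ℚ)) :* (x' :- con 0ℚ))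
                  refl (fromℕ h) (fromℕ h'))
               Δ≡0)

    atom-vertex : ∀ {h j K} → j ≡ 0 → OnSegment (point K) bottom (point (h , j)) → K ≡ (h , j)
    atom-vertex {h} {K = K} refl s =
      point-injective (segment-top bottom (point (h , 0)) s (bottom-below 0) (fromℕ-nonNeg (proj₂ K)))

    atom-edge-meets-edge : ∀ {q h j I J} → j ≡ 0 → IsInterval w (h , j) → I ⋖ J →
                           OnSegment q bottom (point (h , j)) → OnSegment q (point I) (point J) →
                           (q ≡ point (h , j)) × (((h , j) ≡ I) ⊎ ((h , j) ≡ J))
    atom-edge-meets-edge {q} {h} {I = I} {J} refl A-int I⋖J s s' =
      q≡A , vertex-on-edge I⋖J A-int (subst (λ p → OnSegment p (point I) (point J)) q≡A s')
      where
      q≡A : q ≡ point (h , 0)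
      q≡A = segment-top bottom (point (h , 0)) s (bottom-below 0)
              (ℚₚ.≤-trans (fromℕ-nonNeg (proj₂ I)) (edge-above-source I⋖J s'))

    map-just : ∀ {K I J : ℕ × ℕ} → (K ≡ I) ⊎ (K ≡ J) → (just K ≡ just I) ⊎ (just K ≡ just J)
    map-just = Sum.map (cong just) (cong just)

    point̄-injective : ∀ {x y} → point̄ x ≡ point̄ y → x ≡ y
    point̄-injective {nothing}       {nothing}       _ = refl
    point̄-injective {nothing}       {just (_ , j)}  e = ⊥-elim (ℚₚ.<⇒≢ (bottom-below j) (cong proj₂ e))
    point̄-injective {just (_ , j)}  {nothing}       e = ⊥-elim (ℚₚ.<⇒≢ (bottom-below j) (sym (cong proj₂ e)))
    point̄-injective {just I}        {just J}        e = cong just (point-injective e)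

    ⋖̄⇒upward : ∀ {x y} → x ⋖̄ y → proj₂ (point̄ x) ℚ.< proj₂ (point̄ y)
    ⋖̄⇒upward {x}        {nothing}       x⋖̄y = ⊥-elim (⋖̄-nothing x⋖̄y)
    ⋖̄⇒upward {nothing}  {just (_ , j)}  _   = bottom-below j
    ⋖̄⇒upward {just I}   {just J}        I⋖̄J = fromℕ-mono-< (⋖⇒len< (just-⋖̄ I⋖̄J))

    ⋖̄-vertex-on-edge : ∀ {x y z} → x ⋖̄ y → IsIntervalBar w z → OnSegment (point̄ z) (point̄ x) (point̄ y) →
                       (z ≡ x) ⊎ (z ≡ y)
    ⋖̄-vertex-on-edge {x}       {nothing} x⋖̄y _ _ = ⊥-elim (⋖̄-nothing x⋖̄y)
    ⋖̄-vertex-on-edge {nothing} {just _} {nothing} _ _ _ = inj₁ refl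
    ⋖̄-vertex-on-edge {nothing} {just _} {just _}  0̂⋖̄A _ s = inj₂ (cong just (atom-vertex (nothing-⋖̄ 0̂⋖̄A) s))
    ⋖̄-vertex-on-edge {just I}  {just J} {nothing} I⋖̄J _ s =
      ⊥-elim (ℚₚ.<-irrefl refl (ℚₚ.<-≤-trans (bottom-below (proj₂ I)) (edge-above-source (just-⋖̄ I⋖̄J) s)))
    ⋖̄-vertex-on-edge {just I}  {just J} {just K}  I⋖̄J K-int s = map-just (vertex-on-edge (just-⋖̄ I⋖̄J) K-int s)

    ⋖̄-edges-meet-at-endpoint : ∀ {q x y x' y'} → x ⋖̄ y → x' ⋖̄ y' → ¬ ((x ≡ x') × (y ≡ y')) →
                               OnSegment q (point̄ x) (point̄ y) → OnSegment q (point̄ x') (point̄ y') →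
                               SharedEndpoint point̄ x y x' y' q
    ⋖̄-edges-meet-at-endpoint {x = x} {nothing} x⋖̄y _ _ _ _ = ⊥-elim (⋖̄-nothing x⋖̄y)
    ⋖̄-edges-meet-at-endpoint {y = just _} {x'} {nothing} _ x'⋖̄y' _ _ _ = ⊥-elim (⋖̄-nothing x'⋖̄y')
    ⋖̄-edges-meet-at-endpoint {x = just I} {just J} {just I'} {just J'} I⋖̄J I'⋖̄J' distinct s s' =
      let (K , K∈ , K∈' , q≡K) = edges-meet-at-endpoint (just-⋖̄ I⋖̄J) (just-⋖̄ I'⋖̄J')
                                   (λ (I≡I' , J≡J') → distinct (cong just I≡I' , cong just J≡J')) s s'
      in just K , map-just K∈ , map-just K∈' , q≡K
    ⋖̄-edges-meet-at-endpoint {x = nothing} {just _} {just I} {just J} 0̂⋖̄A I⋖̄J _ s s' =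
      let (q≡A , A∈) = atom-edge-meets-edge (nothing-⋖̄ 0̂⋖̄A) (proj₁ (proj₂ 0̂⋖̄A)) (just-⋖̄ I⋖̄J) s s'
      in _ , inj₂ refl , map-just A∈ , q≡A
    ⋖̄-edges-meet-at-endpoint {x = just I} {just J} {nothing} {just _} I⋖̄J 0̂⋖̄A _ s s' =
      let (q≡A , A∈) = atom-edge-meets-edge (nothing-⋖̄ 0̂⋖̄A) (proj₁ (proj₂ 0̂⋖̄A)) (just-⋖̄ I⋖̄J) s' s
      in _ , map-just A∈ , inj₂ refl , q≡A
    ⋖̄-edges-meet-at-endpoint {x = nothing} {just _} {nothing} {just _} 0̂⋖̄A 0̂⋖̄A' distinct s s' =
      nothing , inj₁ refl , inj₁ refl ,
      atom-edges-meet-at-bottom (nothing-⋖̄ 0̂⋖̄A) (nothing-⋖̄ 0̂⋖̄A') (λ A≡A' → distinct (refl , cong just A≡A')) s s'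

    closed-interval-poset-planar : Planar (IsIntervalBar w) _⊑̄_
    closed-interval-poset-planar =
      point̄ ,
      (λ x y _ _ → point̄-injective {x} {y}) ,
      (λ _ _ → ⋖̄⇒upward) ,
      (λ _ _ _ → ⋖̄-vertex-on-edge) ,
      (λ _ _ _ _ x⋖̄y x'⋖̄y' distinct q → ⋖̄-edges-meet-at-endpoint {q} x⋖̄y x'⋖̄y' distinct)

theorem3p2 : (n : ℕ) (w : Permutation′ n) →
    Planar (IsInterval w) _⊑_ × Planar (IsIntervalBar w) _⊑̄_
theorem3p2 n w = Drawing.interval-poset-planar w , Drawing.closed-interval-poset-planar w
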